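{- Consider anonymous PV systems (sites carry no identifiers). There is no deterministic exploration algorithm that, given no information on the system period $p$ (nor on any upper bound on it), solves PVG-Exploration on every feasible homogeneous anonymous PV graph. This impossibility holds even if the algorithm may depend on the number of sites $n$ and the number of carriers $k$ (i.e. the agent knows $n$ and $k$), and even if the agent has unlimited memory.
   Context: A PV system consists of a finite set $S$ of $n$ sites and a set $C$ of $k\le n$ carriers. Each carrier $c$ has a unique identifier $id(c)$ and a route $\pi(c)=\langle x_0,\dots,x_{p(c)-1}\rangle$, a finite sequence of sites $x_i\in S$; $p(c)$ is the period of $c$, and $\pi(c)[j]$ denotes $x_{j \bmod p(c)}$ for every integer $j$. At each time $t=0,1,2,\dots$ carrier $c$ moves from $\pi(c)[t]$ to $\pi(c)[t+1]$. The set of routes $R$ defines the PV graph $\vec G_R$: the directed edge-labelled multigraph on $S$ whose edges are $\bigcup_{c}\{(x_i,x_{i+1},i):0\le i<p(c)\}$ (indices mod $p(c)$). The system period is $p=\max_c p(c)$. The system is homogeneous if all $p(c)$ are equal, heterogeneous otherwise. An exploring agent is placed at time $0$ at a starting site $x\in\{\pi(c)[0]:c\in C\}$. If at time $t$ the agent is at site $y$, it observes the identifiers of the carriers $c$ with $\pi(c)[t]=y$ (and, in a system with distinct ids, the identifier of $y$; in an anonymous system sites are indistinguishable), and either halts (exits the system) or chooses one such carrier $c$ and moves with it to $\pi(c)[t+1]$, arriving at time $t+1$; each such step is one move. A concrete walk is a sequence of edges $(a_i,a_{i+1},i)$, $i=0,1,\dots$, where for each $i$ some carrier $c_i$ has $\pi(c_i)[i]=a_i$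 and $\pi(c_i)[i+1]=a_{i+1}$; it is a concrete cover if it visits every site of $S$. $\vec G_R$ is feasible if from every starting site there exists a finite concrete cover. An exploration algorithm solves PVG-Exploration on $\vec G_R$ if, from every starting site, the agent visits all sites of $S$ and halts after finitely many moves. -}

module Defs where

open import Data.Nat using (ℕ; zero; suc; _≤_)
open import Data.Nat.DivMod using (_mod_)
open import Data.Fin using (Fin; _≟_)
open import Data.Fin.Subset using (Subset)
open import Data.Vec using (Vec; lookup; tabulate)
open import Data.List using (List; []; _∷ʳ_)
open import Data.Maybe using (Maybe; just; nothing)
open import Data.Bool using (Bool; true; false)
open import Data.Product using (Σ; ∃; _×_; _,_)
open import Relation.Nullary.Decidable using (⌊_⌋)
open import Relation.Binary.PropositionalEquality using (_≡_)

-- A homogeneous PV system with n sites (Fin n) and k carriers (ids Fin k).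
-- All carriers share the common period p = suc q (≥ 1).
record PV (n k : ℕ) : Set where
  field
    q     : ℕ
    route : Fin k → Vec (Fin n) (suc q)

  period : ℕ
  period = suc q

  pos : Fin k → ℕ → Fin n
  pos c t = lookup (route c) (t mod (suc q))

open PV public

StartSite : ∀ {n k} → PV n k → Fin n → Set
StartSite P x = ∃ λ c → pos P c 0 ≡ x

ConcreteCoverFrom : ∀ {n k} → PV n k → Fin n → Set
ConcreteCoverFrom {n} {k} P x =
  Σ ℕ λ T → Σ (ℕ → Fin n) λ a →
    (a 0 ≡ x)
    × (∀ i → suc i Data.Nat.≤ T → ∃ λ c → pos P c i ≡ a i × pos P c (suc i) ≡ a (suc i))
    × (∀ y → ∃ λ i → i Data.Nat.≤ T × a i ≡ y)

Feasible : ∀ {n k} → PV n k → Set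
Feasible {n} P = ∀ (x : Fin n) → StartSite P x → ConcreteCoverFrom P x

-- Anonymous observation at time t at site y: the set of carriers present
-- (site identity is not observed).
observe : ∀ {n k} → PV n k → ℕ → Fin n → Subset k
observe P t y = tabulate λ c → ⌊ pos P c t ≟ y ⌋

-- A deterministic algorithm with unlimited memory, for known n and k:
-- given the full history of observations (oldest first, including the current
-- one), either halt (nothing) or choose a carrier id (just c).
Algorithm : ℕ → ℕ → Set
Algorithm n k = List (Subset k) → Maybe (Fin k)

data Run (n k : ℕ) : Set where
  at     : Fin n → List (Subset k) → Run n k  -- current site, observations of earlier times
  halted : Run n k
  failed : Run n k                             -- chose a carrier not present

step : ∀ {n k} → PV n k → Algorithm n k → ℕ → Run n k → Run n k
step P A t (at y h) with A (h ∷ʳ observe P t y)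
... | nothing = halted
... | just c with lookup (observe P t y) c
...   | true  = at (pos P c (suc t)) (h ∷ʳ observe P t y)
...   | false = failed
step P A t halted = halted
step P A t failed = failed

run : ∀ {n k} → PV n k → Algorithm n k → Fin n → ℕ → Run n k
run P A x zero    = at x []
run P A x (suc t) = step P A t (run P A x t)

Solves : ∀ {n k} → Algorithm n k → PV n k → Set
Solves {n} {k} A P = ∀ (x : Fin n) → StartSite P x →
  (∀ (y : Fin n) → ∃ λ t → ∃ λ h → run P A x t ≡ at y h)
  × (∃ λ T → run P A x T ≡ halted)

module Submission where

-- In a system with a single carrier the agent, as long as it
-- rides that carrier, always observes the same thing: "the one carrier is
-- here".  Hence its behaviour is a fixed "blind run", independent of the
-- system: it keeps moving for some number of steps and then halts (or not),
-- the same on every one-carrier system.  Its position at time t is simply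
-- the carrier's position at time t.
--
-- We then consider the family `delayed m` of homogeneous anonymous systems
-- with two sites and one carrier whose route stays on site 0 for m+1 steps
-- and then visits site 1 (period m+2).  Each of them is feasible, since
-- riding the carrier covers both sites.  A correct algorithm must halt on
-- `delayed 0`, say at time T; by the blind-run argument it then halts at time
-- T on `delayed T` as well, having only seen site 0 — so it fails there.

open import Defs
open import Data.Nat using (ℕ; zero; suc; _≤_; _<_; _%_; _≤′_; ≤′-refl; ≤′-step; z≤n; s≤s)
open import Data.Nat.Properties using (≤-refl; <⇒≤; m≤n⇒m≤1+n; ≰⇒>; ≤⇒≤′)
open import Data.Nat.DivMod using (_mod_; m<n⇒m%n≡m)
open import Data.Fin using (Fin; toℕ; _≟_) renaming (zero to fzero; suc to fsuc)
open import Data.Fin.Properties using (toℕ-fromℕ<)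
open import Data.Fin.Subset using (Subset; ⊤)
open import Data.Vec using (lookup; tabulate; _∷_; [])
open import Data.Vec.Properties using (lookup∘tabulate)
open import Data.List as List using (List; _∷ʳ_)
open import Data.Bool using (true)
open import Data.Maybe using (just; nothing)
open import Data.Product using (Σ; ∃; _×_; _,_; proj₁; proj₂)
open import Relation.Nullary using (¬_)
open import Relation.Nullary.Decidable using (⌊_⌋; isYes≗does; dec-true)
open import Relation.Binary.PropositionalEquality using (_≡_; refl; sym; trans; cong)
open Relation.Binary.PropositionalEquality.≡-Reasoning

pos-tabulate : ∀ {n k} (P : PV n k) (c : Fin k) (f : ℕ → Fin n) →
               route P c ≡ tabulate (λ i → f (toℕ i)) →
               ∀ t → t < period P → pos P c t ≡ f t
pos-tabulate P c f route≡ t t<p = begin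
  lookup (route P c) (t mod period P)                      ≡⟨ cong (λ r → lookup r (t mod period P)) route≡ ⟩
  lookup (tabulate (λ i → f (toℕ i))) (t mod period P)     ≡⟨ lookup∘tabulate (λ i → f (toℕ i)) (t mod period P) ⟩
  f (toℕ (t mod period P))                                 ≡⟨ cong f (toℕ-fromℕ< _) ⟩
  f (t % period P)                                         ≡⟨ cong f (m<n⇒m%n≡m t<p) ⟩
  f t                                                      ∎

-- If every carrier's route covers all sites within time T, the system is
-- feasible: from any starting site, ride a carrier that starts there.
feasible-if-routes-cover : ∀ {n k} (P : PV n k) (T : ℕ) →
  (∀ c y → ∃ λ i → i ≤ T × pos P c i ≡ y) → Feasible P
feasible-if-routes-cover P T covers x (c , starts-at-x) =
  T , pos P c , starts-at-x , (λ i _ → c , refl , refl) , covers c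

waitThenMove : ℕ → ℕ → Fin 2
waitThenMove zero    zero    = fzero
waitThenMove zero    (suc t) = fsuc fzero
waitThenMove (suc m) zero    = fzero
waitThenMove (suc m) (suc t) = waitThenMove m t

waitThenMove-waits : ∀ m t → t ≤ m → waitThenMove m t ≡ fzero
waitThenMove-waits zero    zero    _         = refl
waitThenMove-waits (suc m) zero    _         = refl
waitThenMove-waits (suc m) (suc t) (s≤s t≤m) = waitThenMove-waits m t t≤m

waitThenMove-moves : ∀ m → waitThenMove m (suc m) ≡ fsuc fzero
waitThenMove-moves zero    = refl
waitThenMove-moves (suc m) = waitThenMove-moves m

delayed : ℕ → PV 2 1
delayed m = record { q = suc m ; route = λ _ → tabulate (λ i → waitThenMove m (toℕ i)) }

delayed-pos : ∀ m t → t < suc (suc m) → pos (delayed m) fzero t ≡ waitThenMove m t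
delayed-pos m = pos-tabulate (delayed m) fzero (waitThenMove m) refl

delayed-feasible : ∀ m → Feasible (delayed m)
delayed-feasible m = feasible-if-routes-cover (delayed m) (suc m) covers
  where
  covers : ∀ c y → ∃ λ i → i ≤ suc m × pos (delayed m) c i ≡ y
  covers fzero fzero        =
    0 , z≤n , trans (delayed-pos m 0 (s≤s z≤n)) (waitThenMove-waits m 0 z≤n)
  covers fzero (fsuc fzero) =
    suc m , ≤-refl , trans (delayed-pos m (suc m) ≤-refl) (waitThenMove-moves m)

module OneCarrier {n : ℕ} (A : Algorithm n 1) where

  seen-here : (x : Fin n) → ⌊ x ≟ x ⌋ ≡ true
  seen-here x = trans (isYes≗does (x ≟ x)) (dec-true (x ≟ x) refl)

  observe-own : (P : PV n 1) (t : ℕ) → observe P t (pos P fzero t) ≡ ⊤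
  observe-own P t = cong (_∷ []) (seen-here (pos P fzero t))

  -- The system-independent behaviour: the history of (all-identical)
  -- observations, or the fact that the agent has halted.
  data Blind : Set where
    moving  : List (Subset 1) → Blind
    stopped : Blind

  blindStep : Blind → Blind
  blindStep (moving h) with A (h ∷ʳ ⊤)
  ... | nothing = stopped
  ... | just _  = moving (h ∷ʳ ⊤)
  blindStep stopped = stopped

  blind : ℕ → Blind
  blind zero    = moving List.[]
  blind (suc t) = blindStep (blind t)

  embed : PV n 1 → ℕ → Blind → Run n 1
  embed P t (moving h) = at (pos P fzero t) h
  embed P t stopped    = halted

  -- One step of the real run tracks one step of the blind run: the agent
  -- sees ⊤, so it makes the same choice and stays with the carrier.
  step-embed : (P : PV n 1) (t : ℕ) (b : Blind) →
               step P A t (embed P t b) ≡ embed P (suc t) (blindStep b)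
  step-embed P t stopped = refl
  step-embed P t (moving h)
    with A (h ∷ʳ observe P t (pos P fzero t)) | A (h ∷ʳ ⊤) | cong (λ o → A (h ∷ʳ o)) (observe-own P t)
  ... | nothing    | .nothing      | refl = refl
  ... | just fzero | .(just fzero) | refl
    with ⌊ pos P fzero t ≟ pos P fzero t ⌋ | seen-here (pos P fzero t)
  ...   | .true | refl = cong (λ o → at (pos P fzero (suc t)) (h ∷ʳ o)) (observe-own P t)

  run-is-blind : (P : PV n 1) (t : ℕ) → run P A (pos P fzero 0) t ≡ embed P t (blind t)
  run-is-blind P zero    = refl
  run-is-blind P (suc t) = begin
    step P A t (run P A (pos P fzero 0) t) ≡⟨ cong (step P A t) (run-is-blind P t) ⟩
    step P A t (embed P t (blind t))       ≡⟨ step-embed P t (blind t) ⟩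
    embed P (suc t) (blindStep (blind t))  ∎

  stays-stopped : ∀ {T t} → blind T ≡ stopped → T ≤′ t → blind t ≡ stopped
  stays-stopped stop ≤′-refl      = stop
  stays-stopped stop (≤′-step le) = cong blindStep (stays-stopped stop le)

  blind-halts : (P : PV n 1) (T : ℕ) → run P A (pos P fzero 0) T ≡ halted → blind T ≡ stopped
  blind-halts P T halts with blind T | run-is-blind P T
  ... | stopped  | _  = refl
  ... | moving h | eq with trans (sym eq) halts
  ...   | ()

  active-is-moving : (P : PV n 1) {t : ℕ} {y : Fin n} {h : List (Subset 1)} →
                     run P A (pos P fzero 0) t ≡ at y h → pos P fzero t ≡ y × blind t ≡ moving h
  active-is-moving P {t} is-at with blind t | run-is-blind P t
  ... | stopped   | eq with trans (sym eq) is-at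
  ...   | ()
  active-is-moving P {t} is-at | moving h′ | eq with trans (sym eq) is-at
  ...   | refl = refl , refl

  confined : (P : PV n 1) {T t : ℕ} {y : Fin n} {h : List (Subset 1)} →
             blind T ≡ stopped → run P A (pos P fzero 0) t ≡ at y h →
             t < T × pos P fzero t ≡ y
  confined P {T} {t} {y} {h} stop is-at = ≰⇒> not-yet-stopped , proj₁ active
    where
    active : pos P fzero t ≡ y × blind t ≡ moving h
    active = active-is-moving P {t} {y} {h} is-at

    not-yet-stopped : ¬ T ≤ t
    not-yet-stopped T≤t with trans (sym (proj₂ active)) (stays-stopped stop (≤⇒≤′ T≤t))
    ... | ()

theorem1 : ¬ (Σ ((n k : ℕ) → Algorithm n k) λ A →
               ∀ (n k : ℕ) → k ≤ n → (P : PV n k) → Feasible P → Solves (A n k) P)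
theorem1 (A , solves) = never-at-site-1 reaches-site-1
  where
  open OneCarrier (A 2 1)
  solves-delayed : ∀ m → Solves (A 2 1) (delayed m)
  solves-delayed m = solves 2 1 (s≤s z≤n) (delayed m) (delayed-feasible m)

  starts : ∀ m → StartSite (delayed m) (pos (delayed m) fzero 0)
  starts m = fzero , refl

  T : ℕ
  T = proj₁ (proj₂ (solves-delayed 0 _ (starts 0)))

  halts-by-T : blind T ≡ stopped
  halts-by-T = blind-halts (delayed 0) T (proj₂ (proj₂ (solves-delayed 0 _ (starts 0))))

  -- On `delayed T` the agent must reach site 1, necessarily before time T.
  reaches-site-1 : ∃ λ t → t < T × pos (delayed T) fzero t ≡ fsuc fzero
  reaches-site-1 with proj₁ (solves-delayed T _ (starts T)) (fsuc fzero)
  ... | t , h , is-at = t , confined (delayed T) halts-by-T is-at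

  -- But before time T the carrier of `delayed T` is still on site 0.
  never-at-site-1 : ¬ (∃ λ t → t < T × pos (delayed T) fzero t ≡ fsuc fzero)
  never-at-site-1 (t , t<T , at-1)
    with trans (sym (waitThenMove-waits T t (<⇒≤ t<T)))
               (trans (sym (delayed-pos T t (s≤s (m≤n⇒m≤1+n (<⇒≤ t<T))))) at-1)
  ... | ()
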